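{- Let $1\le k\le n-1$ be integers and let $T_{k,n}$ be the cycle matroid of the graph obtained from a cycle of length $k+1$ by replacing one edge with $n-k$ parallel edges, where the $k$ remaining cycle edges are labeled $1,\dots,k$ and the $n-k$ parallel edges are labeled $k+1,\dots,n$. Then its matroid polytope is \[ \mathscr{P}(T_{k,n}) = \left\{ x\in [0,1]^n : \sum_{i=1}^n x_i = k \text{ and }\sum_{i=k+1}^{n} x_i\leq 1 \right\}.\]
   Context: For a matroid $M$ on $\{1,\dots,n\}$, its matroid polytope is $\mathscr{P}(M)=\operatorname{conv}\{\sum_{i\in B}e_i : B \text{ a basis of } M\}\subseteq\mathbb{R}^n$.
   Formalization: The matroid polytope and the set $[0,1]^n$ are taken over ℚ: only points with rational coordinates, and convex combinations with rational weights, are considered in place of points of $\mathbb{R}^n$. -}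

module Defs where

open import Data.Nat as ℕ using (ℕ; _<ᵇ_)
open import Data.Bool using (Bool; true; false; if_then_else_)
open import Data.Fin using (Fin; toℕ; zero; suc)
open import Data.Fin.Subset using (Subset; _∈_; _⊆_; _-_)
open import Data.Vec using (lookup)
open import Data.Product using (_×_; _,_; ∃)
open import Data.List using (List; []; _∷_)
open import Data.List.Relation.Unary.All using (All)
open import Data.Rational using (ℚ; 0ℚ; 1ℚ; _+_; _*_; _≤_)
open import Relation.Nullary using (¬_)
open import Relation.Binary.PropositionalEquality using (_≡_)

-- The graph G_{k,n}: vertices 0,…,k (as naturals); edges are Fin n.
-- Edge i (0-based; paper label i+1) with i < k joins vertices i and i+1
-- (the k remaining cycle edges), edges i ≥ k (paper labels k+1,…,n)
-- all join vertex k and vertex 0 (the n-k parallel copies of the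
-- replaced edge of the (k+1)-cycle).

end₁ : (k : ℕ) {n : ℕ} → Fin n → ℕ
end₁ k i = if toℕ i <ᵇ k then toℕ i else k

end₂ : (k : ℕ) {n : ℕ} → Fin n → ℕ
end₂ k i = if toℕ i <ᵇ k then ℕ.suc (toℕ i) else 0

data Reach (k : ℕ) {n : ℕ} (S : Subset n) : ℕ → ℕ → Set where
  here : ∀ {u} → Reach k S u u
  fwd  : ∀ {u} (e : Fin n) → e ∈ S → Reach k S u (end₁ k e) → Reach k S u (end₂ k e)
  bwd  : ∀ {u} (e : Fin n) → e ∈ S → Reach k S u (end₂ k e) → Reach k S u (end₁ k e)

-- Independent sets of the cycle matroid: edge sets containing no cycle,
-- i.e. no edge of S has its endpoints joined by a path in S ∖ {e}.
Independent : (k : ℕ) {n : ℕ} → Subset n → Set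
Independent k {n} S = ∀ (e : Fin n) → e ∈ S → ¬ Reach k (S - e) (end₁ k e) (end₂ k e)

IsBasis : (k : ℕ) {n : ℕ} → Subset n → Set
IsBasis k {n} B = Independent k B × (∀ (C : Subset n) → Independent k C → B ⊆ C → C ⊆ B)

indicator : {n : ℕ} → Subset n → Fin n → ℚ
indicator B i = if lookup B i then 1ℚ else 0ℚ

sumᶠ : {n : ℕ} → (Fin n → ℚ) → ℚ
sumᶠ {ℕ.zero}  f = 0ℚ
sumᶠ {ℕ.suc n} f = f zero + sumᶠ (λ i → f (suc i))

-- Σ_{i=k+1}^{n} x_i (paper labels), i.e. 0-based indices i with i ≥ k.
sumFrom : (k : ℕ) {n : ℕ} → (Fin n → ℚ) → ℚ
sumFrom k x = sumᶠ (λ i → if toℕ i <ᵇ k then 0ℚ else x i)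

combo : {n : ℕ} → List (ℚ × Subset n) → Fin n → ℚ
combo []             i = 0ℚ
combo ((λ' , B) ∷ l) i = λ' * indicator B i + combo l i

weightSum : {n : ℕ} → List (ℚ × Subset n) → ℚ
weightSum []             = 0ℚ
weightSum ((λ' , B) ∷ l) = λ' + weightSum l

ValidTerm : (k : ℕ) {n : ℕ} → ℚ × Subset n → Set
ValidTerm k (λ' , B) = (0ℚ ≤ λ') × IsBasis k B

InMatroidPolytope : (k : ℕ) {n : ℕ} → (Fin n → ℚ) → Set
InMatroidPolytope k {n} x =
  ∃ λ (l : List (ℚ × Subset n)) →
    All (ValidTerm k) l × weightSum l ≡ 1ℚ × (∀ i → x i ≡ combo l i)

module Submission where

-- An edge set is independent iff it contains at most one parallel edge, and misses some
-- path edge whenever it contains one; cycles are excluded by exhibiting, for each edge, a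
-- cut of the graph that no other edge of the set crosses. Hence the bases are the path P
-- and the sets P − j + p (j a path edge, p a parallel edge), whose indicator vectors satisfy
-- the inequalities, and the inequalities survive convex combinations. Conversely, put
-- s = Σ_{p ≥ k} x_p and y_j = 1 − x_j for j < k; then Σ_j y_j = s, and
--   x = (1 − s) e_P + Σ_{j,p} (y_j x_p / s) e_{P − j + p}.

open import Defs
open import Data.Nat using (ℕ; _<_)
open import Data.Fin using (Fin)
open import Data.Integer using (+_)
open import Data.Rational using (ℚ; 0ℚ; 1ℚ; _≤_; _/_)
open import Data.Product using (_×_)
open import Relation.Binary.PropositionalEquality using (_≡_)

open import Algebra.Bundles using (CommutativeRing)
open import Data.Bool using (Bool; true; false; not; _xor_; if_then_else_)
open import Data.Bool.Properties using (T-≡; if-eta; xor-same; xor-∧-commutativeRing)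
open import Algebra.Properties.CommutativeSemigroup
  (CommutativeRing.+-commutativeSemigroup xor-∧-commutativeRing) using (interchange)
open import Data.Nat as ℕ using (zero; suc; _<ᵇ_; s≤s)
open import Data.Nat.Properties as ℕ using (<ᵇ-reflects-<)
import Data.Fin as Fin
open import Data.Fin using (toℕ; fromℕ<)
open import Data.Fin.Properties using (_≟_; toℕ-injective; toℕ-fromℕ<; toℕ<n; any?)
open import Data.Fin.Subset using (Subset; _∈_; _∉_; _⊆_; _─_; _∪_; ⁅_⁆; outside) renaming (_-_ to _∖_)
open import Data.Fin.Subset.Properties
  using (p─q⊆p; x∈p∧x≢y⇒x∈p-y; x∈⁅x⁆; x∈⁅y⁆⇒x≡y; x∈p∪q⁻; p⊆p∪q; q⊆p∪q; ⊆-antisym; _∈?_)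
import Data.Integer as ℤ
import Data.Integer.Properties as ℤ
open import Data.List as List using (List; []; _∷_; _++_; concat)
open import Data.List.Relation.Unary.All using (All; []; _∷_)
open import Data.List.Relation.Unary.All.Properties using (concat⁺; tabulate⁺)
open import Data.Product using (_,_; ∃; ∃₂; proj₁; proj₂)
open import Data.Rational using (_+_; _*_; _-_; -_; 1/_; toℚᵘ; nonNegative; ≢-nonZero)
import Data.Rational.Properties as ℚ
import Data.Rational.Unnormalised as ℚᵘ
import Data.Rational.Unnormalised.Properties as ℚᵘ
open import Data.Rational.Solver using (module +-*-Solver)
open import Data.Sum using (_⊎_; inj₁; inj₂; map₂)
open import Data.Vec using (_∷_; lookup; tabulate; here; there)
open import Data.Vec.Properties using (lookup∘tabulate; []=⇒lookup; lookup⇒[]=)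
open import Function using (_∘_)
open import Function.Bundles using (Equivalence)
open import Relation.Binary.Definitions using (tri<; tri≈; tri>)
open import Relation.Nullary using (¬_; Dec; yes; no; does; ofʸ; contradiction; _×-dec_; ¬?)
open import Relation.Nullary.Decidable using (dec-true; dec-false)
open import Relation.Binary.PropositionalEquality
  using (_≢_; refl; sym; trans; cong; cong₂; subst; subst₂; module ≡-Reasoning)

open +-*-Solver using (solve; _:+_; _:-_; _:*_; _:=_; con)

<ᵇ-true : ∀ {m n} → m < n → (m <ᵇ n) ≡ true
<ᵇ-true m<n = Equivalence.to T-≡ (ℕ.<⇒<ᵇ m<n)

<ᵇ-false : ∀ {m n} → n ℕ.≤ m → (m <ᵇ n) ≡ false
<ᵇ-false {m} {n} n≤m with m <ᵇ n | <ᵇ-reflects-< m n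
... | false | _       = refl
... | true  | ofʸ m<n = contradiction m<n (ℕ.≤⇒≯ n≤m)

<ᵇ-suc : ∀ {c m} → m ≢ c → (c <ᵇ m) ≡ (c <ᵇ suc m)
<ᵇ-suc {c} {m} m≢c with ℕ.<-cmp c m
... | tri< c<m _ _ = trans (<ᵇ-true c<m) (sym (<ᵇ-true (ℕ.m<n⇒m<1+n c<m)))
... | tri≈ _ c≡m _ = contradiction (sym c≡m) m≢c
... | tri> _ _ m<c = trans (<ᵇ-false (ℕ.<⇒≤ m<c)) (sym (<ᵇ-false m<c))

xor≡false⇒≡ : ∀ {a b} → a xor b ≡ false → a ≡ b
xor≡false⇒≡ {false} {false} _ = refl
xor≡false⇒≡ {true}  {true}  _ = refl

x∈p∖y⁻ : ∀ {n} {x y : Fin n} (p : Subset n) → x ∈ p ∖ y → x ∈ p × x ≢ y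
x∈p∖y⁻ {x = x} {y} p x∈p∖y = p─q⊆p p ⁅ y ⁆ x∈p∖y , x≢y
  where
    ∉-subtrahend : ∀ {n} {x : Fin n} (p q : Subset n) → x ∈ p ─ q → x ∉ q
    ∉-subtrahend (_ ∷ p) (outside ∷ q) here      ()
    ∉-subtrahend (_ ∷ p) (_ ∷ q)       (there m) (there m′) = ∉-subtrahend p q m m′
    x≢y : x ≢ y
    x≢y refl = ∉-subtrahend p ⁅ x ⁆ x∈p∖y (x∈⁅x⁆ x)

∈∧∉⇒toℕ≢ : ∀ {n} {S : Subset n} {i j} → i ∈ S → j ∉ S → toℕ i ≢ toℕ j
∈∧∉⇒toℕ≢ i∈S j∉S i≡j = j∉S (subst (_∈ _) (toℕ-injective i≡j) i∈S)

x∈p∪⁅y⁆⁻ : ∀ {n} {x y : Fin n} (p : Subset n) → x ∈ p ∪ ⁅ y ⁆ → x ∈ p ⊎ x ≡ y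
x∈p∪⁅y⁆⁻ {y = y} p = map₂ (x∈⁅y⁆⇒x≡y y) ∘ x∈p∪q⁻ p ⁅ y ⁆

x∈tabulate⁺ : ∀ {n} {f : Fin n → Bool} {x} → f x ≡ true → x ∈ tabulate f
x∈tabulate⁺ {f = f} {x} fx = lookup⇒[]= x _ (trans (lookup∘tabulate f x) fx)

x∈tabulate⁻ : ∀ {n} {f : Fin n → Bool} {x} → x ∈ tabulate f → f x ≡ true
x∈tabulate⁻ {f = f} {x} m = trans (sym (lookup∘tabulate f x)) ([]=⇒lookup m)

-- The cut between the vertices ≤ c and those > c; for c < k it is crossed by path edge c
-- and by every parallel edge.
above : ℕ → ℕ → Bool
above c v = c <ᵇ v

module _ (k : ℕ) {n : ℕ} where

  Path Parallel : Fin n → Set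
  Path i = toℕ i < k
  Parallel i = k ℕ.≤ toℕ i

  isPath : Fin n → Bool
  isPath i = toℕ i <ᵇ k

  path-or-parallel : ∀ i → Path i ⊎ Parallel i
  path-or-parallel i = ℕ.<-≤-connex (toℕ i) k

  path≢parallel : ∀ {i j} → Path i → Parallel j → i ≢ j
  path≢parallel i<k k≤j refl = ℕ.<⇒≱ i<k k≤j

  module _ {f : Fin n} where

    end₁-path : Path f → end₁ k f ≡ toℕ f
    end₁-path f<k rewrite <ᵇ-true f<k = refl

    end₂-path : Path f → end₂ k f ≡ suc (toℕ f)
    end₂-path f<k rewrite <ᵇ-true f<k = refl

    end₁-parallel : Parallel f → end₁ k f ≡ k
    end₁-parallel k≤f rewrite <ᵇ-false k≤f = refl

    end₂-parallel : Parallel f → end₂ k f ≡ 0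
    end₂-parallel k≤f rewrite <ᵇ-false k≤f = refl

  crosses : (ℕ → Bool) → Fin n → Bool
  crosses X f = X (end₁ k f) xor X (end₂ k f)

  crosses-xor : ∀ X Y f → crosses (λ v → X v xor Y v) f ≡ crosses X f xor crosses Y f
  crosses-xor X Y f = interchange (X (end₁ k f)) (Y (end₁ k f)) (X (end₂ k f)) (Y (end₂ k f))

  module _ {f : Fin n} where

    above-path-crossed : Path f → crosses (above (toℕ f)) f ≡ true
    above-path-crossed f<k rewrite end₁-path f<k | end₂-path f<k
      | <ᵇ-false (ℕ.≤-refl {toℕ f}) | <ᵇ-true (ℕ.n<1+n (toℕ f)) = refl

    above-path-uncrossed : ∀ {c} → Path f → toℕ f ≢ c → crosses (above c) f ≡ false
    above-path-uncrossed {c} f<k f≢c rewrite end₁-path f<k | end₂-path f<k | <ᵇ-suc f≢c =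
      xor-same (c <ᵇ suc (toℕ f))

    above-parallel-crossed : ∀ {c} → c < k → Parallel f → crosses (above c) f ≡ true
    above-parallel-crossed c<k k≤f rewrite end₁-parallel k≤f | end₂-parallel k≤f | <ᵇ-true c<k = refl

  Reach-respects : ∀ {S u v} X → (∀ {f} → f ∈ S → crosses X f ≡ false) → Reach k S u v → X u ≡ X v
  Reach-respects X uncrossed here          = refl
  Reach-respects X uncrossed (fwd f f∈S r) =
    trans (Reach-respects X uncrossed r) (xor≡false⇒≡ (uncrossed f∈S))
  Reach-respects X uncrossed (bwd f f∈S r) =
    trans (Reach-respects X uncrossed r) (sym (xor≡false⇒≡ (uncrossed f∈S)))

  sole-crossing⇒¬Reach : ∀ {S e} X → crosses X e ≡ true →
                         (∀ {f} → f ∈ S ∖ e → crosses X f ≡ false) →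
                         ¬ Reach k (S ∖ e) (end₁ k e) (end₂ k e)
  sole-crossing⇒¬Reach {e = e} X crossed uncrossed r =
    contradiction (trans (sym crossed) uncrossed-e) λ ()
    where
      uncrossed-e : crosses X e ≡ false
      uncrossed-e = trans (cong (_xor X (end₂ k e)) (Reach-respects X uncrossed r))
                          (xor-same (X (end₂ k e)))

  AtMostOneParallel PathOnly ContainsPath MissesPathEdge Forest : Subset n → Set
  AtMostOneParallel S = ∀ {p q} → Parallel p → Parallel q → p ∈ S → q ∈ S → p ≡ q
  PathOnly S          = ∀ {i} → i ∈ S → Path i
  ContainsPath S      = ∀ {i} → Path i → i ∈ S
  MissesPathEdge S    = ∃ λ j → Path j × j ∉ S
  Forest S            = AtMostOneParallel S × (PathOnly S ⊎ MissesPathEdge S)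

  forest⇒independent : ∀ {S} → Forest S → Independent k S
  forest⇒independent {S} (amo , gap) e e∈S with path-or-parallel e | gap
  ... | inj₁ e<k | inj₁ pathOnly =
    sole-crossing⇒¬Reach (above (toℕ e)) (above-path-crossed e<k) uncrossed
    where
      uncrossed : ∀ {f} → f ∈ S ∖ e → crosses (above (toℕ e)) f ≡ false
      uncrossed f∈S-e with x∈p∖y⁻ S f∈S-e
      ... | f∈S , f≢e = above-path-uncrossed (pathOnly f∈S) (f≢e ∘ toℕ-injective)
  ... | inj₁ e<k | inj₂ (j , j<k , j∉S) =
    sole-crossing⇒¬Reach X crossed uncrossed
    where
      -- Parallel edges cross both cuts, hence not their symmetric difference.
      X : ℕ → Bool
      X v = above (toℕ e) v xor above (toℕ j) v
      crossed : crosses X e ≡ true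
      crossed rewrite crosses-xor (above (toℕ e)) (above (toℕ j)) e
        | above-path-crossed e<k | above-path-uncrossed e<k (∈∧∉⇒toℕ≢ e∈S j∉S) = refl
      uncrossed : ∀ {f} → f ∈ S ∖ e → crosses X f ≡ false
      uncrossed {f} f∈S-e rewrite crosses-xor (above (toℕ e)) (above (toℕ j)) f
        with x∈p∖y⁻ S f∈S-e | path-or-parallel f
      ... | f∈S , f≢e | inj₁ f<k
        rewrite above-path-uncrossed f<k (f≢e ∘ toℕ-injective)
              | above-path-uncrossed f<k (∈∧∉⇒toℕ≢ f∈S j∉S) = refl
      ... | _ | inj₂ k≤f
        rewrite above-parallel-crossed e<k k≤f | above-parallel-crossed j<k k≤f = refl
  ... | inj₂ k≤e | inj₁ pathOnly = contradiction (pathOnly e∈S) (ℕ.≤⇒≯ k≤e)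
  ... | inj₂ k≤e | inj₂ (j , j<k , j∉S) =
    sole-crossing⇒¬Reach (above (toℕ j)) (above-parallel-crossed j<k k≤e) uncrossed
    where
      uncrossed : ∀ {f} → f ∈ S ∖ e → crosses (above (toℕ j)) f ≡ false
      uncrossed {f} f∈S-e with x∈p∖y⁻ S f∈S-e | path-or-parallel f
      ... | f∈S , _   | inj₁ f<k = above-path-uncrossed f<k (∈∧∉⇒toℕ≢ f∈S j∉S)
      ... | f∈S , f≢e | inj₂ k≤f = contradiction (amo k≤f k≤e f∈S e∈S) f≢e

  Reach-path⁻ : ∀ {S u v f} → Path f → f ∈ S → toℕ f ≡ v → Reach k S u (suc v) → Reach k S u v
  Reach-path⁻ {S} {f = f} f<k f∈S refl r =
    subst (Reach k S _) (end₁-path f<k) (bwd f f∈S (subst (Reach k S _) (sym (end₂-path f<k)) r))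

  Reach-to-0 : ∀ {S u} → k ℕ.≤ n → ContainsPath S → ∀ v → v ℕ.≤ k → Reach k S u v → Reach k S u 0
  Reach-to-0 k≤n allPath zero    _   r = r
  Reach-to-0 k≤n allPath (suc v) v<k r =
    Reach-to-0 k≤n allPath v (ℕ.<⇒≤ v<k) (Reach-path⁻ f<k (allPath f<k) (toℕ-fromℕ< v<n) r)
    where
      v<n : v < n
      v<n = ℕ.<-≤-trans v<k k≤n
      f<k : Path (fromℕ< v<n)
      f<k = subst (_< k) (sym (toℕ-fromℕ< v<n)) v<k

  two-parallel⇒¬independent : ∀ {S p q} → Parallel p → Parallel q → p ≢ q → p ∈ S → q ∈ S →
                              ¬ Independent k S
  two-parallel⇒¬independent {S} {p} {q} k≤p k≤q p≢q p∈S q∈S ind =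
    ind p p∈S (subst₂ (Reach k (S ∖ p))
                      (trans (end₁-parallel k≤q) (sym (end₁-parallel k≤p)))
                      (trans (end₂-parallel k≤q) (sym (end₂-parallel k≤p)))
                      (fwd q (x∈p∧x≢y⇒x∈p-y q∈S (p≢q ∘ sym)) here))

  parallel∧path⇒¬independent : ∀ {S p} → Parallel p → p ∈ S → ContainsPath S → ¬ Independent k S
  parallel∧path⇒¬independent {S} {p} k≤p p∈S allPath ind =
    ind p p∈S (subst₂ (Reach k (S ∖ p)) (sym (end₁-parallel k≤p)) (sym (end₂-parallel k≤p))
                      (Reach-to-0 k≤n allPath′ k ℕ.≤-refl here))
    where
      k≤n : k ℕ.≤ n
      k≤n = ℕ.<⇒≤ (ℕ.≤-<-trans k≤p (toℕ<n p))
      allPath′ : ContainsPath (S ∖ p)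
      allPath′ i<k = x∈p∧x≢y⇒x∈p-y (allPath i<k) (path≢parallel i<k k≤p)

  ¬parallel⇒pathOnly : ∀ {S} → ¬ (∃ λ p → Parallel p × p ∈ S) → PathOnly S
  ¬parallel⇒pathOnly noParallel {i} i∈S with path-or-parallel i
  ... | inj₁ i<k = i<k
  ... | inj₂ k≤i = contradiction (i , k≤i , i∈S) noParallel

  parallel∈? : ∀ S → Dec (∃ λ p → Parallel p × p ∈ S)
  parallel∈? S = any? (λ p → (k ℕ.≤? toℕ p) ×-dec (p ∈? S))

  pathOnly⇒forest : ∀ {S} → PathOnly S → Forest S
  pathOnly⇒forest pathOnly =
    (λ k≤p _ p∈S _ → contradiction (pathOnly p∈S) (ℕ.≤⇒≯ k≤p)) , inj₁ pathOnly

  independent⇒forest : ∀ {S} → Independent k S → Forest S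
  independent⇒forest {S} ind = amo , gap
    where
      amo : AtMostOneParallel S
      amo {p} {q} k≤p k≤q p∈S q∈S with p ≟ q
      ... | yes p≡q = p≡q
      ... | no  p≢q = contradiction ind (two-parallel⇒¬independent k≤p k≤q p≢q p∈S q∈S)
      gap : PathOnly S ⊎ MissesPathEdge S
      gap with parallel∈? S
      ... | no noParallel = inj₁ (¬parallel⇒pathOnly noParallel)
      ... | yes (p , k≤p , p∈S) with any? (λ j → (toℕ j ℕ.<? k) ×-dec ¬? (j ∈? S))
      ...   | yes missing = inj₂ missing
      ...   | no noMissing = contradiction ind (parallel∧path⇒¬independent k≤p p∈S allPath)
        where
          allPath : ContainsPath S
          allPath {i} i<k with i ∈? S
          ... | yes i∈S = i∈S
          ... | no  i∉S = contradiction (i , i<k , i∉S) noMissing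

  pathSet : Subset n
  pathSet = tabulate isPath

  inExchange : Fin n → Fin n → Fin n → Bool
  inExchange j p i = if isPath i then not (does (i ≟ j)) else does (i ≟ p)

  exchange : Fin n → Fin n → Subset n
  exchange j p = tabulate (inExchange j p)

  module _ {i : Fin n} where

    ∈pathSet⁺ : Path i → i ∈ pathSet
    ∈pathSet⁺ i<k = x∈tabulate⁺ (<ᵇ-true i<k)

    ∈pathSet⁻ : i ∈ pathSet → Path i
    ∈pathSet⁻ i∈ = ℕ.<ᵇ⇒< (toℕ i) k (Equivalence.from T-≡ (x∈tabulate⁻ i∈))

    module _ {j p : Fin n} where

      inExchange-path : Path i → inExchange j p i ≡ not (does (i ≟ j))
      inExchange-path i<k rewrite <ᵇ-true i<k = refl

      inExchange-parallel : Parallel i → inExchange j p i ≡ does (i ≟ p)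
      inExchange-parallel k≤i rewrite <ᵇ-false k≤i = refl

      ∈exchange-path⁺ : Path i → i ≢ j → i ∈ exchange j p
      ∈exchange-path⁺ i<k i≢j =
        x∈tabulate⁺ (trans (inExchange-path i<k) (cong not (dec-false (i ≟ j) i≢j)))

      ∈exchange-path⁻ : Path i → i ∈ exchange j p → i ≢ j
      ∈exchange-path⁻ i<k i∈ refl with () ←
        trans (sym (trans (inExchange-path i<k) (cong not (dec-true (i ≟ i) refl)))) (x∈tabulate⁻ i∈)

      ∈exchange-parallel⁻ : Parallel i → i ∈ exchange j p → i ≡ p
      ∈exchange-parallel⁻ k≤i i∈ with i ≟ p | trans (sym (inExchange-parallel k≤i)) (x∈tabulate⁻ i∈)
      ... | yes i≡p | _  = i≡p
      ... | no  _   | ()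

  ∈exchange-parallel⁺ : ∀ {j p} → Parallel p → p ∈ exchange j p
  ∈exchange-parallel⁺ {p = p} k≤p =
    x∈tabulate⁺ (trans (inExchange-parallel k≤p) (dec-true (p ≟ p) refl))

  pathSet-isBasis : IsBasis k pathSet
  pathSet-isBasis = forest⇒independent (pathOnly⇒forest ∈pathSet⁻) , maximal
    where
      maximal : ∀ C → Independent k C → pathSet ⊆ C → C ⊆ pathSet
      maximal C indC pathSet⊆C {q} q∈C with path-or-parallel q
      ... | inj₁ q<k = ∈pathSet⁺ q<k
      ... | inj₂ k≤q =
        contradiction indC (parallel∧path⇒¬independent k≤q q∈C (pathSet⊆C ∘ ∈pathSet⁺))

  exchange-isBasis : ∀ {j p} → Path j → Parallel p → IsBasis k (exchange j p)
  exchange-isBasis {j} {p} j<k k≤p =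
    forest⇒independent (amo , inj₂ (j , j<k , λ j∈ → ∈exchange-path⁻ j<k j∈ refl)) , maximal
    where
      amo : AtMostOneParallel (exchange j p)
      amo k≤p′ k≤q′ p′∈ q′∈ =
        trans (∈exchange-parallel⁻ k≤p′ p′∈) (sym (∈exchange-parallel⁻ k≤q′ q′∈))
      p∈exchange = ∈exchange-parallel⁺ k≤p
      maximal : ∀ C → Independent k C → exchange j p ⊆ C → C ⊆ exchange j p
      maximal C indC exchange⊆C {q} q∈C with path-or-parallel q
      ... | inj₂ k≤q =
        subst (_∈ exchange j p)
              (proj₁ (independent⇒forest indC) k≤p k≤q (exchange⊆C p∈exchange) q∈C) p∈exchange
      ... | inj₁ q<k with q ≟ j
      ...   | no q≢j = ∈exchange-path⁺ q<k q≢j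
      ...   | yes refl = contradiction indC (parallel∧path⇒¬independent k≤p (exchange⊆C p∈exchange) allPath)
        where
          allPath : ContainsPath C
          allPath {i} i<k with i ≟ q
          ... | yes refl = q∈C
          ... | no  i≢q  = exchange⊆C (∈exchange-path⁺ i<k i≢q)

  module _ {S : Subset n} {i : Fin n} (i<k : Path i) where

    ∪-path-pathOnly : PathOnly S → PathOnly (S ∪ ⁅ i ⁆)
    ∪-path-pathOnly pathOnly x∈ with x∈p∪⁅y⁆⁻ S x∈
    ... | inj₁ x∈S = pathOnly x∈S
    ... | inj₂ refl = i<k

    ∪-path-amo : AtMostOneParallel S → AtMostOneParallel (S ∪ ⁅ i ⁆)
    ∪-path-amo amo k≤p k≤q p∈ q∈ = amo k≤p k≤q (parallel∈S k≤p p∈) (parallel∈S k≤q q∈)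
      where
        parallel∈S : ∀ {x} → Parallel x → x ∈ S ∪ ⁅ i ⁆ → x ∈ S
        parallel∈S k≤x x∈ with x∈p∪⁅y⁆⁻ S x∈
        ... | inj₁ x∈S = x∈S
        ... | inj₂ refl = contradiction refl (path≢parallel i<k k≤x)

  maximal-∪ : ∀ {B i} → IsBasis k B → Forest (B ∪ ⁅ i ⁆) → i ∈ B
  maximal-∪ {B} {i} (_ , maximal) forest =
    maximal (B ∪ ⁅ i ⁆) (forest⇒independent forest) (p⊆p∪q ⁅ i ⁆) (q⊆p∪q B ⁅ i ⁆ (x∈⁅x⁆ i))

  basis-cases : ∀ {B} → IsBasis k B → B ≡ pathSet ⊎ ∃₂ λ j p → Path j × Parallel p × B ≡ exchange j p
  basis-cases {B} basis with independent⇒forest (proj₁ basis)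
  ... | _ , inj₁ pathOnly = inj₁ (⊆-antisym (∈pathSet⁺ ∘ pathOnly) pathSet⊆B)
    where
      pathSet⊆B : pathSet ⊆ B
      pathSet⊆B x∈ = maximal-∪ basis (pathOnly⇒forest (∪-path-pathOnly (∈pathSet⁻ x∈) pathOnly))
  ... | amo , inj₂ (j , j<k , j∉B) with parallel∈? B
  ...   | no noParallel = contradiction (maximal-∪ basis forest) j∉B
    where
      forest : Forest (B ∪ ⁅ j ⁆)
      forest = pathOnly⇒forest (∪-path-pathOnly j<k (¬parallel⇒pathOnly noParallel))
  ...   | yes (p , k≤p , p∈B) = inj₂ (j , p , j<k , k≤p , ⊆-antisym B⊆exchange exchange⊆B)
    where
      B⊆exchange : B ⊆ exchange j p
      B⊆exchange {x} x∈B with path-or-parallel x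
      ... | inj₁ x<k = ∈exchange-path⁺ x<k λ { refl → j∉B x∈B }
      ... | inj₂ k≤x = subst (_∈ exchange j p) (amo k≤p k≤x p∈B x∈B) (∈exchange-parallel⁺ k≤p)
      exchange⊆B : exchange j p ⊆ B
      exchange⊆B {x} x∈ with path-or-parallel x
      ... | inj₂ k≤x = subst (_∈ B) (sym (∈exchange-parallel⁻ k≤x x∈)) p∈B
      ... | inj₁ x<k = maximal-∪ basis (∪-path-amo x<k amo , inj₂ (j , j<k , j∉B∪x))
        where
          j∉B∪x : j ∉ B ∪ ⁅ x ⁆
          j∉B∪x j∈ with x∈p∪⁅y⁆⁻ B j∈
          ... | inj₁ j∈B = j∉B j∈B
          ... | inj₂ refl = ∈exchange-path⁻ x<k x∈ refl

⟦_⟧ : Bool → ℚ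
⟦ b ⟧ = if b then 1ℚ else 0ℚ

-- Since + m / 1 normalises through a gcd and does not compute for a variable m, the
-- identity is checked on unnormalised representatives.
1+m/1≡[1+m]/1 : ∀ m → 1ℚ + + m / 1 ≡ + suc m / 1
1+m/1≡[1+m]/1 m = ℚ.toℚᵘ-injective (begin
    toℚᵘ (1ℚ + + m / 1)
      ≈⟨ ℚ.toℚᵘ-homo-+ 1ℚ (+ m / 1) ⟩
    toℚᵘ 1ℚ ℚᵘ.+ toℚᵘ (+ m / 1)
      ≈⟨ ℚᵘ.+-congʳ (toℚᵘ 1ℚ) (ℚ.toℚᵘ-fromℚᵘ (ℚᵘ.mkℚᵘ (+ m) 0)) ⟩
    toℚᵘ 1ℚ ℚᵘ.+ ℚᵘ.mkℚᵘ (+ m) 0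
      ≈⟨ ℚᵘ.*≡* (cong (λ z → (+ 1 ℤ.+ z) ℤ.* + 1) (ℤ.*-identityʳ (+ m))) ⟩
    ℚᵘ.mkℚᵘ (+ suc m) 0
      ≈⟨ ℚ.toℚᵘ-fromℚᵘ (ℚᵘ.mkℚᵘ (+ suc m) 0) ⟨
    toℚᵘ (+ suc m / 1) ∎)
  where open ℚᵘ.≃-Reasoning

sumᶠ-cong : ∀ {n} {f g : Fin n → ℚ} → (∀ i → f i ≡ g i) → sumᶠ f ≡ sumᶠ g
sumᶠ-cong {zero}  _   = refl
sumᶠ-cong {suc n} f≗g = cong₂ _+_ (f≗g Fin.zero) (sumᶠ-cong (f≗g ∘ Fin.suc))

sumᶠ-zero : ∀ n → sumᶠ {n} (λ _ → 0ℚ) ≡ 0ℚ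
sumᶠ-zero zero    = refl
sumᶠ-zero (suc n) = cong (_+_ 0ℚ) (sumᶠ-zero n)

sumᶠ-+ : ∀ {n} (f g : Fin n → ℚ) → sumᶠ (λ i → f i + g i) ≡ sumᶠ f + sumᶠ g
sumᶠ-+ {zero}  f g = refl
sumᶠ-+ {suc n} f g = trans (cong (_+_ (f Fin.zero + g Fin.zero)) (sumᶠ-+ (f ∘ Fin.suc) (g ∘ Fin.suc)))
  (solve 4 (λ a b c d → (a :+ b) :+ (c :+ d) := (a :+ c) :+ (b :+ d)) refl
     (f Fin.zero) (g Fin.zero) (sumᶠ (f ∘ Fin.suc)) (sumᶠ (g ∘ Fin.suc)))

sumᶠ-sub : ∀ {n} (f g : Fin n → ℚ) → sumᶠ (λ i → f i - g i) ≡ sumᶠ f - sumᶠ g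
sumᶠ-sub {zero}  f g = refl
sumᶠ-sub {suc n} f g = trans (cong (_+_ (f Fin.zero - g Fin.zero)) (sumᶠ-sub (f ∘ Fin.suc) (g ∘ Fin.suc)))
  (solve 4 (λ a b c d → (a :- b) :+ (c :- d) := (a :+ c) :- (b :+ d)) refl
     (f Fin.zero) (g Fin.zero) (sumᶠ (f ∘ Fin.suc)) (sumᶠ (g ∘ Fin.suc)))

sumᶠ-*ˡ : ∀ {n} a (f : Fin n → ℚ) → sumᶠ (λ i → a * f i) ≡ a * sumᶠ f
sumᶠ-*ˡ {zero}  a f = sym (ℚ.*-zeroʳ a)
sumᶠ-*ˡ {suc n} a f = trans (cong (_+_ (a * f Fin.zero)) (sumᶠ-*ˡ a (f ∘ Fin.suc)))
  (sym (ℚ.*-distribˡ-+ a (f Fin.zero) (sumᶠ (f ∘ Fin.suc))))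

sumᶠ-*ʳ : ∀ {n} a (f : Fin n → ℚ) → sumᶠ (λ i → f i * a) ≡ sumᶠ f * a
sumᶠ-*ʳ a f = trans (sumᶠ-cong (λ i → ℚ.*-comm (f i) a)) (trans (sumᶠ-*ˡ a f) (ℚ.*-comm a (sumᶠ f)))

sumᶠ-linear : ∀ {n} a (f g : Fin n → ℚ) → sumᶠ (λ i → a * f i + g i) ≡ a * sumᶠ f + sumᶠ g
sumᶠ-linear a f g = trans (sumᶠ-+ (λ i → a * f i) g) (cong (_+ sumᶠ g) (sumᶠ-*ˡ a f))

sumᶠ-δ : ∀ {n} (f : Fin n → ℚ) j → sumᶠ (λ i → if does (i ≟ j) then f i else 0ℚ) ≡ f j
sumᶠ-δ {suc n} f Fin.zero    = trans (cong (_+_ (f Fin.zero)) (sumᶠ-zero n)) (ℚ.+-identityʳ (f Fin.zero))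
sumᶠ-δ {suc n} f (Fin.suc j) = trans (ℚ.+-identityˡ _) (sumᶠ-δ (f ∘ Fin.suc) j)

sumᶠ-except : ∀ {n} (f : Fin n → ℚ) j → sumᶠ (λ i → if does (i ≟ j) then 0ℚ else f i) ≡ sumᶠ f - f j
sumᶠ-except f j = begin
    sumᶠ (λ i → if does (i ≟ j) then 0ℚ else f i)           ≡⟨ sumᶠ-cong except≗f-δ ⟩
    sumᶠ (λ i → f i - (if does (i ≟ j) then f i else 0ℚ))   ≡⟨ sumᶠ-sub f _ ⟩
    sumᶠ f - sumᶠ (λ i → if does (i ≟ j) then f i else 0ℚ)  ≡⟨ cong (_-_ (sumᶠ f)) (sumᶠ-δ f j) ⟩
    sumᶠ f - f j                                             ∎
  where
    open ≡-Reasoning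
    except≗f-δ : ∀ i → (if does (i ≟ j) then 0ℚ else f i) ≡ f i - (if does (i ≟ j) then f i else 0ℚ)
    except≗f-δ i with does (i ≟ j)
    ... | true  = sym (ℚ.+-inverseʳ (f i))
    ... | false = sym (ℚ.+-identityʳ (f i))

sumᶠ-count : ∀ {k n} → k ℕ.≤ n → sumᶠ {n} (λ i → ⟦ toℕ i <ᵇ k ⟧) ≡ + k / 1
sumᶠ-count {zero}  {n}     _         = sumᶠ-zero n
sumᶠ-count {suc k} {suc n} (s≤s k≤n) = trans (cong (_+_ 1ℚ) (sumᶠ-count k≤n)) (1+m/1≡[1+m]/1 k)

0≤1 : 0ℚ ≤ 1ℚ
0≤1 = ℚ.nonNegative⁻¹ 1ℚ

*-nonNeg : ∀ {p q} → 0ℚ ≤ p → 0ℚ ≤ q → 0ℚ ≤ p * q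
*-nonNeg {p} {q} 0≤p 0≤q =
  ℚ.nonNegative⁻¹ (p * q) {{ℚ.nonNeg*nonNeg⇒nonNeg p {{nonNegative 0≤p}} q {{nonNegative 0≤q}}}}

p≤q⇒0≤q-p : ∀ {p q} → p ≤ q → 0ℚ ≤ q - p
p≤q⇒0≤q-p {p} p≤q = ℚ.≤-trans (ℚ.≤-reflexive (sym (ℚ.+-inverseʳ p))) (ℚ.+-monoˡ-≤ (- p) p≤q)

p≤p+q : ∀ {p q} → 0ℚ ≤ q → p ≤ p + q
p≤p+q {p} 0≤q = ℚ.≤-trans (ℚ.≤-reflexive (sym (ℚ.+-identityʳ p))) (ℚ.+-monoʳ-≤ p 0≤q)

q≤p+q : ∀ {p q} → 0ℚ ≤ p → q ≤ p + q
q≤p+q {p} {q} 0≤p = subst (q ≤_) (ℚ.+-comm q p) (p≤p+q 0≤p)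

sumᶠ-nonNeg : ∀ {n} {f : Fin n → ℚ} → (∀ i → 0ℚ ≤ f i) → 0ℚ ≤ sumᶠ f
sumᶠ-nonNeg {zero}  _   = ℚ.≤-refl
sumᶠ-nonNeg {suc n} 0≤f = ℚ.+-mono-≤ (0≤f Fin.zero) (sumᶠ-nonNeg (0≤f ∘ Fin.suc))

≤sumᶠ : ∀ {n} {f : Fin n → ℚ} → (∀ i → 0ℚ ≤ f i) → ∀ i → f i ≤ sumᶠ f
≤sumᶠ 0≤f Fin.zero    = p≤p+q (sumᶠ-nonNeg (0≤f ∘ Fin.suc))
≤sumᶠ 0≤f (Fin.suc i) = ℚ.≤-trans (≤sumᶠ (0≤f ∘ Fin.suc) i) (q≤p+q (0≤f Fin.zero))

sumᶠ≡0⇒≡0 : ∀ {n} {f : Fin n → ℚ} → (∀ i → 0ℚ ≤ f i) → sumᶠ f ≡ 0ℚ → ∀ i → f i ≡ 0ℚ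
sumᶠ≡0⇒≡0 0≤f Σf≡0 i = ℚ.≤-antisym (ℚ.≤-trans (≤sumᶠ 0≤f i) (ℚ.≤-reflexive Σf≡0)) (0≤f i)

-- With the junk value 0⁻¹ = 0.
_⁻¹ : ℚ → ℚ
p ⁻¹ with p ℚ.≟ 0ℚ
... | yes _   = 0ℚ
... | no  p≢0 = (1/ p) {{≢-nonZero p≢0}}

⁻¹-nonNeg : ∀ {p} → 0ℚ ≤ p → 0ℚ ≤ p ⁻¹
⁻¹-nonNeg {p} 0≤p with p ℚ.≟ 0ℚ
... | yes _   = ℚ.≤-refl
... | no  p≢0 = ℚ.nonNegative⁻¹ p⁻¹ {{ℚ.pos⇒nonNeg p⁻¹ {{ℚ.1/pos⇒pos p {{p>0}}}}}}
  where
    p⁻¹ = (1/ p) {{≢-nonZero p≢0}}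
    p>0 = ℚ.nonNeg∧nonZero⇒pos p {{nonNegative 0≤p}} {{≢-nonZero p≢0}}

*-⁻¹-cancel : ∀ {p q} → (p ≡ 0ℚ → q ≡ 0ℚ) → q * (p ⁻¹ * p) ≡ q
*-⁻¹-cancel {p} {q} p≡0⇒q≡0 with p ℚ.≟ 0ℚ
... | yes p≡0 rewrite p≡0⇒q≡0 p≡0 = ℚ.*-zeroˡ (0ℚ * p)
... | no  p≢0 = trans (cong (q *_) (ℚ.*-inverseˡ p {{≢-nonZero p≢0}})) (ℚ.*-identityʳ q)

module _ {n : ℕ} where

  combo-++ : ∀ (l l′ : List (ℚ × Subset n)) i → combo (l ++ l′) i ≡ combo l i + combo l′ i
  combo-++ []             l′ i = sym (ℚ.+-identityˡ (combo l′ i))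
  combo-++ ((λ′ , B) ∷ l) l′ i = trans (cong (_+_ (λ′ * indicator B i)) (combo-++ l l′ i))
                                       (sym (ℚ.+-assoc (λ′ * indicator B i) (combo l i) (combo l′ i)))

  weightSum-++ : ∀ (l l′ : List (ℚ × Subset n)) → weightSum (l ++ l′) ≡ weightSum l + weightSum l′
  weightSum-++ []             l′ = sym (ℚ.+-identityˡ (weightSum l′))
  weightSum-++ ((λ′ , B) ∷ l) l′ = trans (cong (_+_ λ′) (weightSum-++ l l′))
                                         (sym (ℚ.+-assoc λ′ (weightSum l) (weightSum l′)))

  combo-tabulate : ∀ {m} (t : Fin m → ℚ × Subset n) i →
                   combo (List.tabulate t) i ≡ sumᶠ (λ a → proj₁ (t a) * indicator (proj₂ (t a)) i)
  combo-tabulate {zero}  t i = refl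
  combo-tabulate {suc m} t i = cong (_+_ (proj₁ (t Fin.zero) * indicator (proj₂ (t Fin.zero)) i))
                                    (combo-tabulate (t ∘ Fin.suc) i)

  weightSum-tabulate : ∀ {m} (t : Fin m → ℚ × Subset n) → weightSum (List.tabulate t) ≡ sumᶠ (proj₁ ∘ t)
  weightSum-tabulate {zero}  t = refl
  weightSum-tabulate {suc m} t = cong (_+_ (proj₁ (t Fin.zero))) (weightSum-tabulate (t ∘ Fin.suc))

  combo-concat : ∀ {m} (F : Fin m → List (ℚ × Subset n)) i →
                 combo (concat (List.tabulate F)) i ≡ sumᶠ (λ a → combo (F a) i)
  combo-concat {zero}  F i = refl
  combo-concat {suc m} F i = trans (combo-++ (F Fin.zero) _ i)
                                   (cong (_+_ (combo (F Fin.zero) i)) (combo-concat (F ∘ Fin.suc) i))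

  weightSum-concat : ∀ {m} (F : Fin m → List (ℚ × Subset n)) →
                     weightSum (concat (List.tabulate F)) ≡ sumᶠ (λ a → weightSum (F a))
  weightSum-concat {zero}  F = refl
  weightSum-concat {suc m} F = trans (weightSum-++ (F Fin.zero) _)
                                     (cong (_+_ (weightSum (F Fin.zero))) (weightSum-concat (F ∘ Fin.suc)))

module _ (k : ℕ) {n : ℕ} (φ : (Fin n → ℚ) → ℚ)
         (φ-zero : φ (λ _ → 0ℚ) ≡ 0ℚ)
         (φ-linear : ∀ a u v → φ (λ i → a * u i + v i) ≡ a * φ u + φ v)
         {lo hi : ℚ} (φ-basis : ∀ {B} → IsBasis k B → lo ≤ φ (indicator B) × φ (indicator B) ≤ hi) where

  combo-bounds : ∀ l → All (ValidTerm k) l →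
                 lo * weightSum l ≤ φ (combo l) × φ (combo l) ≤ hi * weightSum l
  combo-bounds [] [] = ℚ.≤-reflexive (trans (ℚ.*-zeroʳ lo) (sym φ-zero)) ,
                       ℚ.≤-reflexive (trans φ-zero (sym (ℚ.*-zeroʳ hi)))
  combo-bounds ((a , B) ∷ l) ((0≤a , basis) ∷ valid) = lower , upper
    where
      open ℚ.≤-Reasoning
      ih = combo-bounds l valid
      a*-mono : ∀ {p q} → p ≤ q → a * p ≤ a * q
      a*-mono = ℚ.*-monoˡ-≤-nonNeg a {{nonNegative 0≤a}}
      lower : lo * (a + weightSum l) ≤ φ (combo ((a , B) ∷ l))
      lower = begin
        lo * (a + weightSum l)
          ≡⟨ solve 3 (λ c a w → c :* (a :+ w) := a :* c :+ c :* w) refl lo a (weightSum l) ⟩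
        a * lo + lo * weightSum l
          ≤⟨ ℚ.+-mono-≤ (a*-mono (proj₁ (φ-basis basis))) (proj₁ ih) ⟩
        a * φ (indicator B) + φ (combo l)
          ≡⟨ φ-linear a (indicator B) (combo l) ⟨
        φ (combo ((a , B) ∷ l)) ∎
      upper : φ (combo ((a , B) ∷ l)) ≤ hi * (a + weightSum l)
      upper = begin
        φ (combo ((a , B) ∷ l))
          ≡⟨ φ-linear a (indicator B) (combo l) ⟩
        a * φ (indicator B) + φ (combo l)
          ≤⟨ ℚ.+-mono-≤ (a*-mono (proj₂ (φ-basis basis))) (proj₂ ih) ⟩
        a * hi + hi * weightSum l
          ≡⟨ solve 3 (λ c a w → a :* c :+ c :* w := c :* (a :+ w)) refl hi a (weightSum l) ⟩
        hi * (a + weightSum l) ∎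

  convex-bounds : ∀ l → All (ValidTerm k) l → weightSum l ≡ 1ℚ →
                  lo ≤ φ (combo l) × φ (combo l) ≤ hi
  convex-bounds l valid Σλ≡1 with combo-bounds l valid
  ... | lower , upper rewrite Σλ≡1 | ℚ.*-identityʳ lo | ℚ.*-identityʳ hi = lower , upper

indicator-bounds : ∀ {n} (B : Subset n) i → 0ℚ ≤ indicator B i × indicator B i ≤ 1ℚ
indicator-bounds B i with lookup B i
... | true  = 0≤1 , ℚ.≤-refl
... | false = ℚ.≤-refl , 0≤1

module _ (k : ℕ) {n : ℕ} where

  sumFrom-cong : ∀ {u v : Fin n → ℚ} → (∀ i → u i ≡ v i) → sumFrom k u ≡ sumFrom k v
  sumFrom-cong u≗v = sumᶠ-cong {n} (λ i → cong (if isPath k i then 0ℚ else_) (u≗v i))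

  sumFrom-zero : sumFrom k {n} (λ _ → 0ℚ) ≡ 0ℚ
  sumFrom-zero = trans (sumᶠ-cong {n} (λ i → if-eta (isPath k i))) (sumᶠ-zero n)

  sumFrom-linear : ∀ a (u v : Fin n → ℚ) →
                   sumFrom k (λ i → a * u i + v i) ≡ a * sumFrom k u + sumFrom k v
  sumFrom-linear a u v = trans (sumᶠ-cong (λ i → masked {i} (isPath k i))) (sumᶠ-linear {n} a _ _)
    where
      masked : ∀ {i} b → (if b then 0ℚ else a * u i + v i) ≡
                         a * (if b then 0ℚ else u i) + (if b then 0ℚ else v i)
      masked true  = sym (trans (ℚ.+-identityʳ (a * 0ℚ)) (ℚ.*-zeroʳ a))
      masked false = refl

  sumFrom-nonNeg : ∀ {u : Fin n → ℚ} → (∀ i → 0ℚ ≤ u i) → 0ℚ ≤ sumFrom k u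
  sumFrom-nonNeg 0≤u = sumᶠ-nonNeg (λ i → masked (isPath k i) (0≤u i))
    where
      masked : ∀ {c} b → 0ℚ ≤ c → 0ℚ ≤ (if b then 0ℚ else c)
      masked true  _   = ℚ.≤-refl
      masked false 0≤c = 0≤c

  indicator-pathSet : ∀ i → indicator (pathSet k {n}) i ≡ ⟦ isPath k i ⟧
  indicator-pathSet i = cong ⟦_⟧ (lookup∘tabulate (isPath k) i)

  indicator-exchange : ∀ {j p : Fin n} → Path k j → Parallel k p → ∀ i →
                       indicator (exchange k j p) i ≡
                       (if does (i ≟ j) then 0ℚ else ⟦ isPath k i ⟧) + ⟦ does (i ≟ p) ⟧
  indicator-exchange {j} {p} j<k k≤p i
    rewrite lookup∘tabulate (inExchange k j p) i with path-or-parallel k i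
  ... | inj₁ i<k
    rewrite inExchange-path k {j = j} {p} i<k | <ᵇ-true i<k
          | dec-false (i ≟ p) (path≢parallel k i<k k≤p) with i ≟ j
  ...   | yes _ = refl
  ...   | no  _ = refl
  indicator-exchange {j} {p} j<k k≤p i | inj₂ k≤i
    rewrite inExchange-parallel k {j = j} {p} k≤i | <ᵇ-false k≤i
          | dec-false (i ≟ j) (path≢parallel k j<k k≤i ∘ sym) with i ≟ p
  ...   | yes _ = refl
  ...   | no  _ = refl

  sumᶠ-indicator-basis : ∀ {B : Subset n} → k ℕ.≤ n → IsBasis k B → sumᶠ (indicator B) ≡ + k / 1
  sumᶠ-indicator-basis k≤n basis with basis-cases k basis
  ... | inj₁ refl = trans (sumᶠ-cong indicator-pathSet) (sumᶠ-count k≤n)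
  ... | inj₂ (j , p , j<k , k≤p , refl) = begin
    sumᶠ (indicator (exchange k j p))    ≡⟨ sumᶠ-cong (indicator-exchange j<k k≤p) ⟩
    sumᶠ (λ i → χ-j i + δ-p i)           ≡⟨ sumᶠ-+ χ-j δ-p ⟩
    sumᶠ χ-j + sumᶠ δ-p                  ≡⟨ cong₂ _+_ (sumᶠ-except χ j) (sumᶠ-δ (λ _ → 1ℚ) p) ⟩
    (sumᶠ χ - χ j) + 1ℚ                  ≡⟨ cong (λ c → (sumᶠ χ - ⟦ c ⟧) + 1ℚ) (<ᵇ-true j<k) ⟩
    (sumᶠ χ - 1ℚ) + 1ℚ                   ≡⟨ solve 1 (λ c → c :- con 1ℚ :+ con 1ℚ := c) refl (sumᶠ χ) ⟩
    sumᶠ χ                               ≡⟨ sumᶠ-count k≤n ⟩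
    + k / 1                              ∎
    where
      open ≡-Reasoning
      χ χ-j δ-p : Fin n → ℚ
      χ i   = ⟦ isPath k i ⟧
      χ-j i = if does (i ≟ j) then 0ℚ else χ i
      δ-p i = ⟦ does (i ≟ p) ⟧

  sumFrom-indicator-basis : ∀ {B : Subset n} → IsBasis k B → sumFrom k (indicator B) ≤ 1ℚ
  sumFrom-indicator-basis basis with basis-cases k basis
  ... | inj₁ refl = ℚ.≤-trans (ℚ.≤-reflexive (trans (sumᶠ-cong parallel-part) (sumᶠ-zero n))) 0≤1
    where
      parallel-part : ∀ i → (if isPath k i then 0ℚ else indicator (pathSet k) i) ≡ 0ℚ
      parallel-part i rewrite indicator-pathSet i with isPath k i
      ... | true  = refl
      ... | false = refl
  ... | inj₂ (j , p , j<k , k≤p , refl) =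
    ℚ.≤-reflexive (trans (sumᶠ-cong parallel-part) (sumᶠ-δ (λ _ → 1ℚ) p))
    where
      parallel-part : ∀ i → (if isPath k i then 0ℚ else indicator (exchange k j p) i) ≡
                            ⟦ does (i ≟ p) ⟧
      parallel-part i with path-or-parallel k i
      ... | inj₁ i<k rewrite <ᵇ-true i<k | dec-false (i ≟ p) (path≢parallel k i<k k≤p) = refl
      ... | inj₂ k≤i rewrite <ᵇ-false k≤i | indicator-exchange j<k k≤p i
                           | dec-false (i ≟ j) (path≢parallel k j<k k≤i ∘ sym) | <ᵇ-false k≤i
                           = ℚ.+-identityˡ ⟦ does (i ≟ p) ⟧

polytope⇒inequalities : ∀ {k n} → k ℕ.≤ n → (x : Fin n → ℚ) → InMatroidPolytope k x →
  (∀ i → (0ℚ ≤ x i) × (x i ≤ 1ℚ)) × (sumᶠ x ≡ (+ k) / 1) × (sumFrom k x ≤ 1ℚ)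
polytope⇒inequalities {k} {n} k≤n x (l , valid , Σλ≡1 , x≗combo) = unitCube , total , parallelTotal
  where
    unitCube : ∀ i → 0ℚ ≤ x i × x i ≤ 1ℚ
    unitCube i = subst (λ c → 0ℚ ≤ c × c ≤ 1ℚ) (sym (x≗combo i))
      (convex-bounds k (λ u → u i) refl (λ _ _ _ → refl) (λ {B} _ → indicator-bounds B i) l valid Σλ≡1)

    total : sumᶠ x ≡ + k / 1
    total with convex-bounds k sumᶠ (sumᶠ-zero n) sumᶠ-linear
                 (λ basis → ℚ.≤-reflexive (sym (sumᶠ-indicator-basis k k≤n basis)) ,
                            ℚ.≤-reflexive (sumᶠ-indicator-basis k k≤n basis))
                 l valid Σλ≡1
    ... | lower , upper = trans (sumᶠ-cong x≗combo) (ℚ.≤-antisym upper lower)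

    parallelTotal : sumFrom k x ≤ 1ℚ
    parallelTotal = subst (_≤ 1ℚ) (sym (sumFrom-cong k x≗combo))
      (proj₂ (convex-bounds k (sumFrom k) (sumFrom-zero k {n}) (sumFrom-linear k)
                (λ {B} basis → sumFrom-nonNeg k (proj₁ ∘ indicator-bounds B) ,
                               sumFrom-indicator-basis k basis)
                l valid Σλ≡1))

module Decomposition {k n : ℕ} (k≤n : k ℕ.≤ n) (x : Fin n → ℚ)
  (0≤x≤1 : ∀ i → (0ℚ ≤ x i) × (x i ≤ 1ℚ))
  (Σx≡k : sumᶠ x ≡ (+ k) / 1) (s≤1 : sumFrom k x ≤ 1ℚ) where

  s : ℚ
  s = sumFrom k x

  P Y a : Fin n → ℚ
  P i = if isPath k i then 0ℚ else x i
  Y i = if isPath k i then 1ℚ - x i else 0ℚ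
  a j = Y j * s ⁻¹

  -- Only pairs of a path edge j and a parallel edge p get a nonzero weight a j * P p;
  -- the basis attached to any other pair is immaterial.
  basisFor : Fin n → Fin n → Subset n
  basisFor j p = if isPath k j then (if isPath k p then pathSet k else exchange k j p) else pathSet k

  term : Fin n → Fin n → ℚ × Subset n
  term j p = a j * P p , basisFor j p

  terms : List (ℚ × Subset n)
  terms = concat (List.tabulate λ j → List.tabulate (term j))

  L : List (ℚ × Subset n)
  L = (1ℚ - s , pathSet k) ∷ terms

  P-nonNeg : ∀ i → 0ℚ ≤ P i
  P-nonNeg i with isPath k i
  ... | true  = ℚ.≤-refl
  ... | false = proj₁ (0≤x≤1 i)

  Y-nonNeg : ∀ i → 0ℚ ≤ Y i
  Y-nonNeg i with isPath k i
  ... | true  = p≤q⇒0≤q-p (proj₂ (0≤x≤1 i))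
  ... | false = ℚ.≤-refl

  s-nonNeg : 0ℚ ≤ s
  s-nonNeg = sumᶠ-nonNeg P-nonNeg

  ΣY≡s : sumᶠ Y ≡ s
  ΣY≡s = begin
    sumᶠ Y                                    ≡⟨ sumᶠ-cong Y≗χ+P-x ⟩
    sumᶠ (λ i → (χ i + P i) - x i)            ≡⟨ sumᶠ-sub (λ i → χ i + P i) x ⟩
    sumᶠ (λ i → χ i + P i) - sumᶠ x           ≡⟨ cong₂ _-_ (sumᶠ-+ χ P) Σx≡k ⟩
    (sumᶠ χ + s) - + k / 1                    ≡⟨ cong (λ c → (c + s) - + k / 1) (sumᶠ-count k≤n) ⟩
    (+ k / 1 + s) - + k / 1                   ≡⟨ solve 2 (λ c t → (c :+ t) :- c := t) refl (+ k / 1) s ⟩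
    s                                         ∎
    where
      open ≡-Reasoning
      χ : Fin n → ℚ
      χ i = ⟦ isPath k i ⟧
      Y≗χ+P-x : ∀ i → Y i ≡ (χ i + P i) - x i
      Y≗χ+P-x i with isPath k i
      ... | true  = refl
      ... | false = sym (trans (cong (_- x i) (ℚ.+-identityˡ (x i))) (ℚ.+-inverseʳ (x i)))

  s≡0⇒P≡0 : s ≡ 0ℚ → ∀ i → P i ≡ 0ℚ
  s≡0⇒P≡0 = sumᶠ≡0⇒≡0 P-nonNeg

  s≡0⇒Y≡0 : s ≡ 0ℚ → ∀ i → Y i ≡ 0ℚ
  s≡0⇒Y≡0 s≡0 = sumᶠ≡0⇒≡0 Y-nonNeg (trans ΣY≡s s≡0)

  sumᶠ-a* : ∀ t → sumᶠ (λ j → a j * t) ≡ s * s ⁻¹ * t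
  sumᶠ-a* t = trans (sumᶠ-*ʳ t a) (cong (_* t) (trans (sumᶠ-*ʳ (s ⁻¹) Y) (cong (_* s ⁻¹) ΣY≡s)))

  weight-nonNeg : ∀ j p → 0ℚ ≤ a j * P p
  weight-nonNeg j p = *-nonNeg (*-nonNeg (Y-nonNeg j) (⁻¹-nonNeg s-nonNeg)) (P-nonNeg p)

  weight≡0⊎valid : ∀ j p → a j * P p ≡ 0ℚ ⊎ (Path k j × Parallel k p)
  weight≡0⊎valid j p with path-or-parallel k j | path-or-parallel k p
  ... | inj₁ j<k | inj₂ k≤p = inj₂ (j<k , k≤p)
  ... | inj₁ _   | inj₁ p<k rewrite <ᵇ-true p<k = inj₁ (ℚ.*-zeroʳ (a j))
  ... | inj₂ k≤j | _        rewrite <ᵇ-false k≤j =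
    inj₁ (trans (cong (_* P p) (ℚ.*-zeroˡ (s ⁻¹))) (ℚ.*-zeroˡ (P p)))

  basisFor-valid : ∀ {j p} → Path k j → Parallel k p → basisFor j p ≡ exchange k j p
  basisFor-valid j<k k≤p rewrite <ᵇ-true j<k | <ᵇ-false k≤p = refl

  basisFor-isBasis : ∀ j p → IsBasis k (basisFor j p)
  basisFor-isBasis j p with path-or-parallel k j | path-or-parallel k p
  ... | inj₁ j<k | inj₂ k≤p rewrite basisFor-valid j<k k≤p = exchange-isBasis k j<k k≤p
  ... | inj₁ j<k | inj₁ p<k rewrite <ᵇ-true j<k | <ᵇ-true p<k = pathSet-isBasis k
  ... | inj₂ k≤j | _        rewrite <ᵇ-false k≤j = pathSet-isBasis k

  term-path : ∀ {i} → Path k i → ∀ j p →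
              a j * P p * indicator (basisFor j p) i ≡ (if does (j ≟ i) then 0ℚ else a j * P p)
  term-path {i} i<k j p with weight≡0⊎valid j p
  ... | inj₁ w≡0 rewrite w≡0 =
    trans (ℚ.*-zeroˡ (indicator (basisFor j p) i)) (sym (if-eta (does (j ≟ i))))
  ... | inj₂ (j<k , k≤p)
    rewrite basisFor-valid j<k k≤p | indicator-exchange k j<k k≤p i | <ᵇ-true i<k
          | dec-false (i ≟ p) (path≢parallel k i<k k≤p) with j ≟ i
  ...   | yes refl rewrite dec-true (i ≟ i) refl = ℚ.*-zeroʳ (a i * P p)
  ...   | no  j≢i  rewrite dec-false (i ≟ j) (j≢i ∘ sym) = ℚ.*-identityʳ (a j * P p)

  term-parallel : ∀ {i} → Parallel k i → ∀ j p →
                  a j * P p * indicator (basisFor j p) i ≡ (if does (p ≟ i) then a j * P p else 0ℚ)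
  term-parallel {i} k≤i j p with weight≡0⊎valid j p
  ... | inj₁ w≡0 rewrite w≡0 =
    trans (ℚ.*-zeroˡ (indicator (basisFor j p) i)) (sym (if-eta (does (p ≟ i))))
  ... | inj₂ (j<k , k≤p)
    rewrite basisFor-valid j<k k≤p | indicator-exchange k j<k k≤p i | <ᵇ-false k≤i
          | dec-false (i ≟ j) (path≢parallel k j<k k≤i ∘ sym) with p ≟ i
  ...   | yes refl rewrite dec-true (i ≟ i) refl = ℚ.*-identityʳ (a j * P i)
  ...   | no  p≢i  rewrite dec-false (i ≟ p) (p≢i ∘ sym) = ℚ.*-zeroʳ (a j * P p)

  combo-terms : ∀ i → combo terms i ≡ sumᶠ (λ j → sumᶠ (λ p → a j * P p * indicator (basisFor j p) i))
  combo-terms i =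
    trans (combo-concat (λ j → List.tabulate (term j)) i) (sumᶠ-cong (λ j → combo-tabulate (term j) i))

  weightSum-terms : weightSum terms ≡ s * s ⁻¹ * s
  weightSum-terms = begin
    weightSum terms                                  ≡⟨ weightSum-concat (λ j → List.tabulate (term j)) ⟩
    sumᶠ (λ j → weightSum (List.tabulate (term j)))  ≡⟨ sumᶠ-cong (λ j → weightSum-tabulate (term j)) ⟩
    sumᶠ (λ j → sumᶠ (λ p → a j * P p))              ≡⟨ sumᶠ-cong (λ j → sumᶠ-*ˡ (a j) P) ⟩
    sumᶠ (λ j → a j * s)                             ≡⟨ sumᶠ-a* s ⟩
    s * s ⁻¹ * s                                     ∎
    where open ≡-Reasoning

  valid : All (ValidTerm k) L
  valid = (p≤q⇒0≤q-p s≤1 , pathSet-isBasis k) ∷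
          concat⁺ (tabulate⁺ λ j → tabulate⁺ {f = term j} λ p → weight-nonNeg j p , basisFor-isBasis j p)

  weightSum≡1 : weightSum L ≡ 1ℚ
  weightSum≡1 = begin
    (1ℚ - s) + weightSum terms        ≡⟨ cong (_+_ (1ℚ - s)) weightSum-terms ⟩
    (1ℚ - s) + s * s ⁻¹ * s           ≡⟨ cong (_+_ (1ℚ - s)) (ℚ.*-assoc s (s ⁻¹) s) ⟩
    (1ℚ - s) + s * (s ⁻¹ * s)         ≡⟨ cong (λ c → (1ℚ - s) + c) (*-⁻¹-cancel (λ s≡0 → s≡0)) ⟩
    (1ℚ - s) + s                      ≡⟨ solve 1 (λ t → (con 1ℚ :- t) :+ t := con 1ℚ) refl s ⟩
    1ℚ                                ∎
    where open ≡-Reasoning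

  x≗combo-path : ∀ {i} → Path k i → x i ≡ combo L i
  x≗combo-path {i} i<k = sym (begin
    (1ℚ - s) * indicator (pathSet k) i + combo terms i
      ≡⟨ cong₂ _+_ (cong (_*_ (1ℚ - s)) (trans (indicator-pathSet k i) (cong ⟦_⟧ (<ᵇ-true i<k))))
                   (combo-terms i) ⟩
    (1ℚ - s) * 1ℚ + sumᶠ (λ j → sumᶠ (λ p → a j * P p * indicator (basisFor j p) i))
      ≡⟨ cong (_+_ ((1ℚ - s) * 1ℚ)) (sumᶠ-cong (λ j → trans (sumᶠ-cong (term-path i<k j)) (inner j))) ⟩
    (1ℚ - s) * 1ℚ + sumᶠ (λ j → if does (j ≟ i) then 0ℚ else a j * s)
      ≡⟨ cong (_+_ ((1ℚ - s) * 1ℚ)) (trans (sumᶠ-except (λ j → a j * s) i)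
                                             (cong (_- a i * s) (sumᶠ-a* s))) ⟩
    (1ℚ - s) * 1ℚ + (s * s ⁻¹ * s - Y i * s ⁻¹ * s)
      ≡⟨ solve 3 (λ t u y → (con 1ℚ :- t) :* con 1ℚ :+ (t :* u :* t :- y :* u :* t)
                          := (con 1ℚ :- t) :+ (t :- y) :* (u :* t)) refl s (s ⁻¹) (Y i) ⟩
    (1ℚ - s) + (s - Y i) * (s ⁻¹ * s)
      ≡⟨ cong (_+_ (1ℚ - s)) (*-⁻¹-cancel (λ s≡0 → cong₂ _-_ s≡0 (s≡0⇒Y≡0 s≡0 i))) ⟩
    (1ℚ - s) + (s - Y i)
      ≡⟨ cong (λ y → (1ℚ - s) + (s - y)) Y-path ⟩
    (1ℚ - s) + (s - (1ℚ - x i))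
      ≡⟨ solve 2 (λ t y → (con 1ℚ :- t) :+ (t :- (con 1ℚ :- y)) := y) refl s (x i) ⟩
    x i ∎)
    where
      open ≡-Reasoning
      inner : ∀ j → sumᶠ (λ p → if does (j ≟ i) then 0ℚ else a j * P p) ≡
                    (if does (j ≟ i) then 0ℚ else a j * s)
      inner j with does (j ≟ i)
      ... | true  = sumᶠ-zero n
      ... | false = sumᶠ-*ˡ (a j) P
      Y-path : Y i ≡ 1ℚ - x i
      Y-path rewrite <ᵇ-true i<k = refl

  x≗combo-parallel : ∀ {i} → Parallel k i → x i ≡ combo L i
  x≗combo-parallel {i} k≤i = sym (begin
    (1ℚ - s) * indicator (pathSet k) i + combo terms i
      ≡⟨ cong₂ _+_ (cong (_*_ (1ℚ - s)) (trans (indicator-pathSet k i) (cong ⟦_⟧ (<ᵇ-false k≤i))))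
                   (combo-terms i) ⟩
    (1ℚ - s) * 0ℚ + sumᶠ (λ j → sumᶠ (λ p → a j * P p * indicator (basisFor j p) i))
      ≡⟨ cong (_+_ ((1ℚ - s) * 0ℚ))
              (sumᶠ-cong (λ j → trans (sumᶠ-cong (term-parallel k≤i j)) (sumᶠ-δ (λ p → a j * P p) i))) ⟩
    (1ℚ - s) * 0ℚ + sumᶠ (λ j → a j * P i)
      ≡⟨ cong (_+_ ((1ℚ - s) * 0ℚ)) (sumᶠ-a* (P i)) ⟩
    (1ℚ - s) * 0ℚ + s * s ⁻¹ * P i
      ≡⟨ solve 3 (λ t u q → (con 1ℚ :- t) :* con 0ℚ :+ t :* u :* q := q :* (u :* t)) refl s (s ⁻¹) (P i) ⟩
    P i * (s ⁻¹ * s)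
      ≡⟨ *-⁻¹-cancel (λ s≡0 → s≡0⇒P≡0 s≡0 i) ⟩
    P i
      ≡⟨ P-parallel ⟩
    x i ∎)
    where
      open ≡-Reasoning
      P-parallel : P i ≡ x i
      P-parallel rewrite <ᵇ-false k≤i = refl

  x≗combo : ∀ i → x i ≡ combo L i
  x≗combo i with path-or-parallel k i
  ... | inj₁ i<k = x≗combo-path i<k
  ... | inj₂ k≤i = x≗combo-parallel k≤i

  inMatroidPolytope : InMatroidPolytope k x
  inMatroidPolytope = L , valid , weightSum≡1 , x≗combo

proposition2p5 : (k n : ℕ) → 1 Data.Nat.≤ k → k < n → (x : Fin n → ℚ) →
    (InMatroidPolytope k x →
      (∀ i → (0ℚ ≤ x i) × (x i ≤ 1ℚ)) × (sumᶠ x ≡ (+ k) / 1) × (sumFrom k x ≤ 1ℚ))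
    × ((∀ i → (0ℚ ≤ x i) × (x i ≤ 1ℚ)) → sumᶠ x ≡ (+ k) / 1 → sumFrom k x ≤ 1ℚ →
      InMatroidPolytope k x)
proposition2p5 k n _ k<n x =
  polytope⇒inequalities k≤n x ,
  λ 0≤x≤1 Σx≡k s≤1 → Decomposition.inMatroidPolytope k≤n x 0≤x≤1 Σx≡k s≤1
  where
    k≤n : k ℕ.≤ n
    k≤n = ℕ.<⇒≤ k<n
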